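{- For every integer $n\ge0$, \[ f_nf_{n+1}=1+\lfloor n/2\rfloor+\sum_{j=1}^n j\,f_{n-j}f_{n-j+1}. \]
   Context: $f_n=F_{n+1}$, where $F_0=0$, $F_1=1$, $F_m=F_{m-1}+F_{m-2}$ are the Fibonacci numbers. An empty sum is $0$. -}

module Defs where

open import Data.Nat using (ℕ; zero; suc; _+_; _*_; _∸_)

F : ℕ → ℕ
F zero = 0
F (suc zero) = 1
F (suc (suc m)) = F (suc m) + F m

f : ℕ → ℕ
f n = F (suc n)

sumFrom1 : ℕ → (ℕ → ℕ) → ℕ
sumFrom1 zero g = 0
sumFrom1 (suc n) g = sumFrom1 n g + g (suc n)

-- Put P n = f n f (n+1). Since f (n+2) − f n = f (n+1), consecutive products differ
-- by a square: P (n+1) = P n + f (n+1)². Cassini's identity, summed, shows that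
-- the partial sums P 0 + ⋯ + P n equal f (n+1)² − (n mod 2). On the right-hand side,
-- passing from n to n+1 adds exactly these partial sums to the weighted sum and
-- n mod 2 to ⌊n/2⌋, so both sides grow by the same amount.
module Submission where

open import Defs
open import Data.Nat using (ℕ; zero; suc; _+_; _*_; _∸_; _/_; _%_; s≤s; z≤n)
open import Data.Nat.Properties using (+-assoc; +-comm; +-cancelʳ-≡; *-identityˡ)
open import Data.Nat.DivMod using (m/n≡1+[m∸n]/n)
open import Data.Nat.Tactic.RingSolver using (solve-∀)
open import Function using (_∘_)
open import Relation.Binary.PropositionalEquality
open ≡-Reasoning

sumFrom1-suc : ∀ n (h : ℕ → ℕ) → sumFrom1 (suc n) h ≡ h 1 + sumFrom1 n (h ∘ suc)
sumFrom1-suc zero    h = +-comm 0 (h 1)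
sumFrom1-suc (suc n) h = begin
  sumFrom1 (suc n) h + h (2 + n)              ≡⟨ cong (_+ h (2 + n)) (sumFrom1-suc n h) ⟩
  h 1 + sumFrom1 n (h ∘ suc) + h (2 + n)      ≡⟨ +-assoc (h 1) _ _ ⟩
  h 1 + (sumFrom1 n (h ∘ suc) + h (2 + n))    ∎

sumFrom1-+ : ∀ n (g h : ℕ → ℕ) →
  sumFrom1 n (λ j → g j + h j) ≡ sumFrom1 n g + sumFrom1 n h
sumFrom1-+ zero    g h = refl
sumFrom1-+ (suc n) g h = begin
  sumFrom1 n (λ j → g j + h j) + (g (suc n) + h (suc n))
    ≡⟨ cong (_+ (g (suc n) + h (suc n))) (sumFrom1-+ n g h) ⟩
  sumFrom1 n g + sumFrom1 n h + (g (suc n) + h (suc n))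
    ≡⟨ interchange (sumFrom1 n g) (sumFrom1 n h) (g (suc n)) (h (suc n)) ⟩
  sumFrom1 n g + g (suc n) + (sumFrom1 n h + h (suc n))
    ∎
  where
  interchange : ∀ p q r s → p + q + (r + s) ≡ p + r + (q + s)
  interchange = solve-∀

sumFrom1-weighted : ∀ n (h : ℕ → ℕ) →
  sumFrom1 (suc n) (λ j → j * h j) ≡ sumFrom1 (suc n) h + sumFrom1 n (λ j → j * h (suc j))
sumFrom1-weighted n h = begin
  sumFrom1 (suc n) (λ j → j * h j)
    ≡⟨ sumFrom1-suc n (λ j → j * h j) ⟩
  1 * h 1 + sumFrom1 n (λ j → h (suc j) + j * h (suc j))
    ≡⟨ cong₂ _+_ (*-identityˡ (h 1)) (sumFrom1-+ n (h ∘ suc) (λ j → j * h (suc j))) ⟩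
  h 1 + (sumFrom1 n (h ∘ suc) + sumFrom1 n (λ j → j * h (suc j)))
    ≡⟨ sym (+-assoc (h 1) _ _) ⟩
  h 1 + sumFrom1 n (h ∘ suc) + sumFrom1 n (λ j → j * h (suc j))
    ≡⟨ cong (_+ sumFrom1 n (λ j → j * h (suc j))) (sym (sumFrom1-suc n h)) ⟩
  sumFrom1 (suc n) h + sumFrom1 n (λ j → j * h (suc j))
    ∎

-- Cassini's identity F (k+1)² − F k F (k+1) − F k² = (−1)ᵏ, with the sign moved
-- to whichever side keeps it in ℕ. The step uses that (k+2) % 2 reduces to k % 2.
cassini : ∀ k → F (suc k) * F (suc k) + k % 2 ≡ F k * F (suc k) + F k * F k + suc k % 2
cassini zero    = refl
cassini (suc k) = step (F k) (F (suc k)) (k % 2) (suc k % 2) (cassini k)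
  where
  step : ∀ x y p q → y * y + p ≡ x * y + x * x + q →
         (y + x) * (y + x) + q ≡ y * (y + x) + y * y + p
  step x y p q ih = begin
    (y + x) * (y + x) + q                ≡⟨ expand x y q ⟩
    y * y + x * y + (x * y + x * x + q)  ≡⟨ cong (y * y + x * y +_) (sym ih) ⟩
    y * y + x * y + (y * y + p)          ≡⟨ collect x y p ⟩
    y * (y + x) + y * y + p              ∎
    where
    expand : ∀ x y q → (y + x) * (y + x) + q ≡ y * y + x * y + (x * y + x * x + q)
    expand = solve-∀
    collect : ∀ x y p → y * y + x * y + (y * y + p) ≡ y * (y + x) + y * y + p
    collect = solve-∀

fibProduct : ℕ → ℕ
fibProduct n = f n * f (suc n)

fibProduct-suc : ∀ n → fibProduct (suc n) ≡ fibProduct n + f (suc n) * f (suc n)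
fibProduct-suc n = expand (F (suc n)) (F (suc (suc n)))
  where
  expand : ∀ x y → y * (y + x) ≡ x * y + y * y
  expand = solve-∀

fibProductSum : ℕ → ℕ
fibProductSum n = sumFrom1 (suc n) (λ j → fibProduct (suc n ∸ j))

fibProductSum-suc : ∀ n → fibProductSum (suc n) ≡ fibProduct (suc n) + fibProductSum n
fibProductSum-suc n = sumFrom1-suc (suc n) (λ j → fibProduct (suc (suc n) ∸ j))

fibProductSum+parity : ∀ n → fibProductSum n + n % 2 ≡ f (suc n) * f (suc n)
fibProductSum+parity zero    = refl
fibProductSum+parity (suc n) = +-cancelʳ-≡ (n % 2) _ _ (begin
  fibProductSum (suc n) + suc n % 2 + n % 2
    ≡⟨ cong (λ t → t + suc n % 2 + n % 2) (fibProductSum-suc n) ⟩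
  fibProduct (suc n) + fibProductSum n + suc n % 2 + n % 2
    ≡⟨ rearrange (fibProduct (suc n)) (fibProductSum n) (suc n % 2) (n % 2) ⟩
  fibProduct (suc n) + (fibProductSum n + n % 2) + suc n % 2
    ≡⟨ cong (λ t → fibProduct (suc n) + t + suc n % 2) (fibProductSum+parity n) ⟩
  fibProduct (suc n) + f (suc n) * f (suc n) + suc n % 2
    ≡⟨ sym (cassini (suc (suc n))) ⟩
  f (suc (suc n)) * f (suc (suc n)) + n % 2
    ∎)
  where
  rearrange : ∀ a b p q → a + b + p + q ≡ a + (b + q) + p
  rearrange = solve-∀

/2-suc-suc : ∀ n → suc (suc n) / 2 ≡ suc (n / 2)
/2-suc-suc n = m/n≡1+[m∸n]/n {suc (suc n)} {2} (s≤s (s≤s z≤n))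

suc/2 : ∀ n → suc n / 2 ≡ n / 2 + n % 2
suc/2 zero          = refl
suc/2 (suc zero)    = refl
suc/2 (suc (suc n)) = begin
  suc (suc (suc n)) / 2    ≡⟨ /2-suc-suc (suc n) ⟩
  suc (suc n / 2)          ≡⟨ cong suc (suc/2 n) ⟩
  suc (n / 2 + n % 2)      ≡⟨ cong (_+ n % 2) (sym (/2-suc-suc n)) ⟩
  suc (suc n) / 2 + n % 2  ∎

weightedSum : ℕ → ℕ
weightedSum n = sumFrom1 n (λ j → j * fibProduct (n ∸ j))

weightedSum-suc : ∀ n → weightedSum (suc n) ≡ fibProductSum n + weightedSum n
weightedSum-suc n = sumFrom1-weighted n (λ j → fibProduct (suc n ∸ j))

mainTheorem15 : (n : ℕ) →
    f n * f (suc n) ≡ 1 + n / 2 + sumFrom1 n (λ j → j * (f (n ∸ j) * f (suc (n ∸ j))))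
mainTheorem15 zero    = refl
mainTheorem15 (suc n) = begin
  fibProduct (suc n)
    ≡⟨ fibProduct-suc n ⟩
  fibProduct n + f (suc n) * f (suc n)
    ≡⟨ cong₂ _+_ (mainTheorem15 n) (sym (fibProductSum+parity n)) ⟩
  1 + n / 2 + weightedSum n + (fibProductSum n + n % 2)
    ≡⟨ regroup (n / 2) (n % 2) (weightedSum n) (fibProductSum n) ⟩
  1 + (n / 2 + n % 2) + (fibProductSum n + weightedSum n)
    ≡⟨ cong₂ (λ s t → 1 + s + t) (sym (suc/2 n)) (sym (weightedSum-suc n)) ⟩
  1 + suc n / 2 + weightedSum (suc n)
    ∎
  where
  regroup : ∀ h p w s → 1 + h + w + (s + p) ≡ 1 + (h + p) + (s + w)
  regroup = solve-∀
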